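{- For integers $1\le m<n$, \[\binom{2n}{n}=\frac{m(n-m)}{(2m+1)^2}\left(\prod_{k=1}^{m+1}\frac{n+k}{n-k+1}\right)\sum_{k=m}^{n}\frac{k+m+1}{k}\,\mathcal{C}_{k,m}\,\mathcal{C}_{n-k,0}.\]
   Context: A path is a finite sequence of points of $\mathbb{Z}^2$ in which each step is $(1,0)$ or $(0,1)$. For integers $0\le m\le n$, $\mathcal{C}_{n,m}$ denotes the number of paths from $(0,-2m)$ to $(n-m,n-m)$ not crossing the line $y=x$, i.e. all of whose points $(p,q)$ satisfy $q\le p$. -}

module Defs where

open import Data.Nat as ℕ using (ℕ; zero; suc; _∸_)
open import Data.Integer as ℤ using (ℤ; +_; -_)
open import Data.List using (List; []; _∷_; filter; length; map; _++_; foldr; upTo)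
open import Data.List.Relation.Unary.All using (All; all?)
open import Data.Product using (_×_; _,_)
open import Data.Product.Properties using (≡-dec)
open import Relation.Nullary using (Dec; _×-dec_)
open import Relation.Binary.PropositionalEquality using (_≡_)
open import Data.Rational as ℚ using (ℚ; _/_)

data Step : Set where
  right up : Step

Point : Set
Point = ℤ × ℤ

move : Point → Step → Point
move (p , q) right = (p ℤ.+ + 1 , q)
move (p , q) up    = (p , q ℤ.+ + 1)

points : Point → List Step → List Point
points s []       = s ∷ []
points s (x ∷ xs) = s ∷ points (move s x) xs

endpoint : Point → List Step → Point
endpoint s []       = s
endpoint s (x ∷ xs) = endpoint (move s x) xs

allSteps : ℕ → List (List Step)
allSteps zero    = [] ∷ []
allSteps (suc l) = map (right ∷_) (allSteps l) ++ map (up ∷_) (allSteps l)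

Below : Point → Set
Below (p , q) = q ℤ.≤ p

below? : (x : Point) → Dec (Below x)
below? (p , q) = q ℤ.≤? p

GoodPath : Point → Point → List Step → Set
GoodPath s t xs = All Below (points s xs) × endpoint s xs ≡ t

goodPath? : (s t : Point) (xs : List Step) → Dec (GoodPath s t xs)
goodPath? s t xs = all? below? (points s xs) ×-dec ≡-dec ℤ._≟_ ℤ._≟_ (endpoint s xs) t

countPaths : Point → Point → ℕ → ℕ
countPaths s t len = length (filter (goodPath? s t) (allSteps len))

-- 𝒞_{n,m}: paths from (0,-2m) to (n-m,n-m) not crossing y = x.
-- Every such path has exactly (n-m) + (n+m) = 2n steps.
𝒞 : ℕ → ℕ → ℕ
𝒞 n m = countPaths (+ 0 , - (+ (2 ℕ.* m))) (+ (n ∸ m) , + (n ∸ m)) (2 ℕ.* n)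

-- natural-number fraction a / b as a rational (convention: a / 0 := 0;
-- only used with positive denominators)
frac : ℕ → ℕ → ℚ
frac a zero    = ℚ.0ℚ
frac a (suc b) = (+ a) / suc b

sumQ : ℕ → ℕ → (ℕ → ℚ) → ℚ
sumQ a b f = foldr (λ k acc → f (a ℕ.+ k) ℚ.+ acc) ℚ.0ℚ (upTo (suc b ∸ a))

prodQ : ℕ → ℕ → (ℕ → ℚ) → ℚ
prodQ a b f = foldr (λ k acc → f (a ℕ.+ k) ℚ.* acc) ℚ.1ℚ (upTo (suc b ∸ a))

-- 𝒞 (m + i) m is the ballot number b(2m, i) of paths starting 2m steps right of
-- the diagonal, and the reflection principle gives b(h, i)·(h + i + 1) = (h + 1)·C(2i + h, h + i).
-- Comparing b(2m, i) with b(2m − 1, i) through this formula turns each weighted term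
-- (k + m + 1)/k · 𝒞_{k,m} 𝒞_{n−k,0} into (2m + 1)/m · b(2m − 1, k − m)·b(0, n − k), and the
-- first-return convolution Σᵢ b(h, i)·b(0, N − i) = b(h + 1, N) sums these to
-- (2m + 1)/m · b(2m, n − m) = (2m + 1)²/(m (n + m + 1)) · C(2n, n + m).  Finally
-- C(2n, n)·∏_{j<m} (n − j) = ∏_{j<m} (n + 1 + j)·C(2n, n + m) telescopes from
-- (k + 1)·C(M, k + 1) = (M − k)·C(M, k).

{-# OPTIONS --safe #-}
module Submission where

open import Defs
open import Data.Nat as ℕ using (ℕ; zero; suc; _+_; _*_; _∸_; _^_; _≤_; _<_; z≤n; s≤s)
import Data.Nat.Properties as ℕ
open import Data.Nat.Combinatorics using (_C_; nCk+nC[k+1]≡[n+1]C[k+1]; nCk≡nC[n∸k]; nC1≡n; k>n⇒nCk≡0)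
open import Data.Nat.Tactic.RingSolver using (solve-∀)
open import Data.Integer as ℤ using (ℤ; +_; -_)
import Data.Integer.Properties as ℤ
import Data.Integer.Tactic.RingSolver as ℤ
open import Data.Rational as ℚ using (ℚ; 0ℚ; 1ℚ)
import Data.Rational.Properties as ℚ
open import Data.Rational.Unnormalised as ℚᵘ using (mkℚᵘ; *≡*)
import Data.Rational.Unnormalised.Properties as ℚᵘ
open import Data.List using (List; []; _∷_; _++_; map; filter; length; foldr; applyUpTo)
open import Data.List.Properties using (length-++; filter-++; filter-accept; filter-none)
open import Data.List.Relation.Unary.All as All using ([]; _∷_)
open import Data.Product using (_,_; proj₁)
open import Relation.Nullary using (¬_; yes; no; contradiction)
open import Relation.Unary using (Pred; Decidable)
open import Relation.Binary.PropositionalEquality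

frac-cross : ∀ {b d} a c → 0 < b → 0 < d → a * d ≡ c * b → frac a b ≡ frac c d
frac-cross {suc b} {suc d} a c _ _ eq =
  ℚ.fromℚᵘ-cong {mkℚᵘ (+ a) b} {mkℚᵘ (+ c) d} (*≡* (trans (sym (ℤ.pos-* a (suc d))) (trans (cong +_ eq) (ℤ.pos-* c (suc b)))))

toℚᵘ-frac : ∀ a b → ℚ.toℚᵘ (frac a (suc b)) ℚᵘ.≃ mkℚᵘ (+ a) b
toℚᵘ-frac a b = ℚ.toℚᵘ-fromℚᵘ (mkℚᵘ (+ a) b)

frac-* : ∀ a b c d → frac a b ℚ.* frac c d ≡ frac (a * c) (b * d)
frac-* a zero    c d = ℚ.*-zeroˡ (frac c d)
frac-* a (suc b) c zero rewrite ℕ.*-zeroʳ b = ℚ.*-zeroʳ (frac a (suc b))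
frac-* a (suc b) c (suc d) = ℚ.toℚᵘ-injective (begin
  ℚ.toℚᵘ (frac a (suc b) ℚ.* frac c (suc d))                  ≈⟨ ℚ.toℚᵘ-homo-* (frac a (suc b)) (frac c (suc d)) ⟩
  ℚ.toℚᵘ (frac a (suc b)) ℚᵘ.* ℚ.toℚᵘ (frac c (suc d))         ≈⟨ ℚᵘ.*-cong (toℚᵘ-frac a b) (toℚᵘ-frac c d) ⟩
  mkℚᵘ (+ a ℤ.* + c) (d + b * suc d)                          ≡⟨ cong (λ n → mkℚᵘ n (d + b * suc d)) (sym (ℤ.pos-* a c)) ⟩
  mkℚᵘ (+ (a * c)) (d + b * suc d)                            ≈⟨ ℚᵘ.≃-sym (toℚᵘ-frac (a * c) (d + b * suc d)) ⟩
  ℚ.toℚᵘ (frac (a * c) (suc b * suc d))                       ∎)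
  where open ℚᵘ.≃-Reasoning

frac-*₃ : ∀ a b c d e f → frac a b ℚ.* frac c d ℚ.* frac e f ≡ frac (a * c * e) (b * d * f)
frac-*₃ a b c d e f = trans (cong (ℚ._* frac e f) (frac-* a b c d)) (frac-* (a * c) (b * d) e f)

frac-+ : ∀ a c d → frac a d ℚ.+ frac c d ≡ frac (a + c) d
frac-+ a c zero    = ℚ.+-identityˡ 0ℚ
frac-+ a c (suc d) = ℚ.toℚᵘ-injective (begin
  ℚ.toℚᵘ (frac a D ℚ.+ frac c D)                          ≈⟨ ℚ.toℚᵘ-homo-+ (frac a D) (frac c D) ⟩
  ℚ.toℚᵘ (frac a D) ℚᵘ.+ ℚ.toℚᵘ (frac c D)                ≈⟨ ℚᵘ.+-cong (toℚᵘ-frac a d) (toℚᵘ-frac c d) ⟩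
  mkℚᵘ (+ a ℤ.* + D ℤ.+ + c ℤ.* + D) (d + d * D)          ≈⟨ *≡* cancel-D ⟩
  mkℚᵘ (+ (a + c)) d                                      ≈⟨ ℚᵘ.≃-sym (toℚᵘ-frac (a + c) d) ⟩
  ℚ.toℚᵘ (frac (a + c) D)                                 ∎)
  where
  open ℚᵘ.≃-Reasoning
  D = suc d
  cancel-D : (+ a ℤ.* + D ℤ.+ + c ℤ.* + D) ℤ.* + D ≡ + (a + c) ℤ.* + (D * D)
  cancel-D = trans (factor (+ a) (+ c) (+ D)) (cong (+ (a + c) ℤ.*_) (sym (ℤ.pos-* D D)))
    where
    factor : ∀ x y z → (x ℤ.* z ℤ.+ y ℤ.* z) ℤ.* z ≡ (x ℤ.+ y) ℤ.* (z ℤ.* z)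
    factor = ℤ.solve-∀

frac-0 : ∀ d → frac 0 d ≡ 0ℚ
frac-0 zero    = refl
frac-0 (suc d) = frac-cross {suc d} {1} 0 0 (s≤s z≤n) (s≤s z≤n) refl

open ≡-Reasoning

∑ : ℕ → (ℕ → ℕ) → ℕ
∑ zero    f = 0
∑ (suc n) f = f 0 + ∑ n (λ i → f (suc i))

syntax ∑ n (λ i → f) = ∑[ i < n ] f

∏ : ℕ → (ℕ → ℕ) → ℕ
∏ zero    f = 1
∏ (suc n) f = f 0 * ∏ n (λ i → f (suc i))

syntax ∏ n (λ i → f) = ∏[ i < n ] f

∑-cong : ∀ n {f g : ℕ → ℕ} → (∀ i → f i ≡ g i) → ∑ n f ≡ ∑ n g
∑-cong zero    f≗g = refl
∑-cong (suc n) f≗g = cong₂ _+_ (f≗g 0) (∑-cong n (λ i → f≗g (suc i)))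

∑-distrib-+ : ∀ n (f g : ℕ → ℕ) → ∑[ i < n ] (f i + g i) ≡ ∑ n f + ∑ n g
∑-distrib-+ zero    f g = refl
∑-distrib-+ (suc n) f g = trans (cong (λ x → f 0 + g 0 + x) (∑-distrib-+ n (λ i → f (suc i)) (λ i → g (suc i))))
                                (interchange (f 0) (g 0) _ _)
  where
  interchange : ∀ a b c d → a + b + (c + d) ≡ (a + c) + (b + d)
  interchange = solve-∀

∑-distribˡ-* : ∀ n c (f : ℕ → ℕ) → ∑[ i < n ] (c * f i) ≡ c * ∑ n f
∑-distribˡ-* zero    c f = sym (ℕ.*-zeroʳ c)
∑-distribˡ-* (suc n) c f = trans (cong (λ x → c * f 0 + x) (∑-distribˡ-* n c (λ i → f (suc i))))
                                 (sym (ℕ.*-distribˡ-+ c (f 0) _))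

∏-snoc : ∀ n (f : ℕ → ℕ) → ∏ (suc n) f ≡ ∏ n f * f n
∏-snoc zero    f = ℕ.*-comm (f 0) 1
∏-snoc (suc n) f = trans (cong (f 0 *_) (∏-snoc n (λ i → f (suc i)))) (sym (ℕ.*-assoc (f 0) _ _))

∏-pos : ∀ n (f : ℕ → ℕ) → (∀ i → i < n → 0 < f i) → 0 < ∏ n f
∏-pos zero    f pos = s≤s z≤n
∏-pos (suc n) f pos = ℕ.*-mono-< (pos 0 (s≤s z≤n)) (∏-pos n (λ i → f (suc i)) (λ i i<n → pos (suc i) (s≤s i<n)))

∏-telescope : ∀ n (a f g : ℕ → ℕ) → (∀ j → j < n → a j * g j ≡ f j * a (suc j)) → a 0 * ∏ n g ≡ ∏ n f * a n
∏-telescope zero    a f g step = ℕ.*-comm (a 0) 1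
∏-telescope (suc n) a f g step = begin
  a 0 * (g 0 * ∏ n (λ j → g (suc j)))   ≡⟨ sym (ℕ.*-assoc (a 0) (g 0) _) ⟩
  a 0 * g 0 * ∏ n (λ j → g (suc j))     ≡⟨ cong (_* ∏ n (λ j → g (suc j))) (step 0 (s≤s z≤n)) ⟩
  f 0 * a 1 * ∏ n (λ j → g (suc j))     ≡⟨ ℕ.*-assoc (f 0) (a 1) _ ⟩
  f 0 * (a 1 * ∏ n (λ j → g (suc j)))   ≡⟨ cong (f 0 *_) (∏-telescope n (λ j → a (suc j)) (λ j → f (suc j)) (λ j → g (suc j))
                                                            (λ j j<n → step (suc j) (s≤s j<n))) ⟩
  f 0 * (∏ n (λ j → f (suc j)) * a (suc n)) ≡⟨ sym (ℕ.*-assoc (f 0) _ (a (suc n))) ⟩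
  f 0 * ∏ n (λ j → f (suc j)) * a (suc n) ∎

foldr-+-frac : ∀ (f : ℕ → ℚ) (F : ℕ → ℕ) d g L → (∀ i → f (g i) ≡ frac (F i) d) →
               foldr (λ k acc → f k ℚ.+ acc) 0ℚ (applyUpTo g L) ≡ frac (∑ L F) d
foldr-+-frac f F d g zero    f≡F = sym (frac-0 d)
foldr-+-frac f F d g (suc L) f≡F =
  trans (cong₂ ℚ._+_ (f≡F 0) (foldr-+-frac f (λ i → F (suc i)) d (λ i → g (suc i)) L (λ i → f≡F (suc i))))
        (frac-+ (F 0) (∑ L (λ i → F (suc i))) d)

foldr-*-frac : ∀ (f : ℕ → ℚ) (A B : ℕ → ℕ) g L → (∀ i → f (g i) ≡ frac (A i) (B i)) →
               foldr (λ k acc → f k ℚ.* acc) 1ℚ (applyUpTo g L) ≡ frac (∏ L A) (∏ L B)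
foldr-*-frac f A B g zero    f≡A/B = refl
foldr-*-frac f A B g (suc L) f≡A/B =
  trans (cong₂ ℚ._*_ (f≡A/B 0) (foldr-*-frac f (λ i → A (suc i)) (λ i → B (suc i)) (λ i → g (suc i)) L (λ i → f≡A/B (suc i))))
        (frac-* (A 0) (B 0) (∏ L (λ i → A (suc i))) (∏ L (λ i → B (suc i))))

sumQ-frac : ∀ a b (f : ℕ → ℚ) (F : ℕ → ℕ) d → (∀ i → f (a + i) ≡ frac (F i) d) →
            sumQ a b f ≡ frac (∑ (suc b ∸ a) F) d
sumQ-frac a b f F d = foldr-+-frac (λ k → f (a + k)) F d (λ i → i) (suc b ∸ a)

prodQ-frac : ∀ a b (f : ℕ → ℚ) (A B : ℕ → ℕ) → (∀ i → f (a + i) ≡ frac (A i) (B i)) →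
             prodQ a b f ≡ frac (∏ (suc b ∸ a) A) (∏ (suc b ∸ a) B)
prodQ-frac a b f A B = foldr-*-frac (λ k → f (a + k)) A B (λ i → i) (suc b ∸ a)

[m+n]Cm≡[m+n]Cn : ∀ m n → (m + n) C m ≡ (m + n) C n
[m+n]Cm≡[m+n]Cn m n = trans (nCk≡nC[n∸k] (ℕ.m≤m+n m n)) (cong ((m + n) C_) (ℕ.m+n∸m≡n m n))

[1+k]*[1+n]C[1+k]≡[1+n]*nCk : ∀ n k → suc k * (suc n C suc k) ≡ suc n * (n C k)
[1+k]*[1+n]C[1+k]≡[1+n]*nCk zero    zero    = refl
[1+k]*[1+n]C[1+k]≡[1+n]*nCk zero    (suc k) = ℕ.*-zeroʳ (suc (suc k))
[1+k]*[1+n]C[1+k]≡[1+n]*nCk (suc n) zero    = trans (ℕ.+-identityʳ _) (trans (nC1≡n (suc (suc n))) (sym (ℕ.*-identityʳ (suc (suc n)))))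
[1+k]*[1+n]C[1+k]≡[1+n]*nCk (suc n) (suc k) = begin
  suc (suc k) * (suc n′ C suc (suc k))            ≡⟨ cong (suc (suc k) *_) (sym (nCk+nC[k+1]≡[n+1]C[k+1] n′ (suc k))) ⟩
  suc (suc k) * (n′ C suc k + n′ C suc (suc k))   ≡⟨ regroup k (n′ C suc k) (n′ C suc (suc k)) ⟩
  (suc k * (n′ C suc k) + n′ C suc k) + suc (suc k) * (n′ C suc (suc k))
    ≡⟨ cong₂ (λ a b → (a + n′ C suc k) + b) ([1+k]*[1+n]C[1+k]≡[1+n]*nCk n k) ([1+k]*[1+n]C[1+k]≡[1+n]*nCk n (suc k)) ⟩
  (n′ * (n C k) + n′ C suc k) + n′ * (n C suc k)  ≡⟨ factor n′ (n C k) (n′ C suc k) (n C suc k) ⟩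
  n′ * (n C k + n C suc k) + n′ C suc k           ≡⟨ cong (λ a → n′ * a + n′ C suc k) (nCk+nC[k+1]≡[n+1]C[k+1] n k) ⟩
  n′ * (n′ C suc k) + n′ C suc k                  ≡⟨ ℕ.+-comm (n′ * (n′ C suc k)) _ ⟩
  suc n′ * (n′ C suc k)                           ∎
  where
  n′ = suc n
  regroup : ∀ k x y → suc (suc k) * (x + y) ≡ (suc k * x + x) + suc (suc k) * y
  regroup = solve-∀
  factor : ∀ n x y z → (n * x + y) + n * z ≡ n * (x + z) + y
  factor = solve-∀

[1+n]*nCk+k*[1+n]Ck≡[1+n]*[1+n]Ck : ∀ n k → suc n * (n C k) + k * (suc n C k) ≡ suc n * (suc n C k)
[1+n]*nCk+k*[1+n]Ck≡[1+n]*[1+n]Ck n zero    = ℕ.+-identityʳ _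
[1+n]*nCk+k*[1+n]Ck≡[1+n]*[1+n]Ck n (suc k) = begin
  suc n * (n C suc k) + suc k * (suc n C suc k) ≡⟨ cong (λ x → suc n * (n C suc k) + x) ([1+k]*[1+n]C[1+k]≡[1+n]*nCk n k) ⟩
  suc n * (n C suc k) + suc n * (n C k)         ≡⟨ sym (ℕ.*-distribˡ-+ (suc n) (n C suc k) (n C k)) ⟩
  suc n * (n C suc k + n C k)                   ≡⟨ cong (suc n *_) (trans (ℕ.+-comm (n C suc k) (n C k)) (nCk+nC[k+1]≡[n+1]C[k+1] n k)) ⟩
  suc n * (suc n C suc k)                       ∎

[1+k]*[j+k]C[1+k]≡j*[j+k]Ck : ∀ j k → suc k * ((j + k) C suc k) ≡ j * ((j + k) C k)
[1+k]*[j+k]C[1+k]≡j*[j+k]Ck zero    k = trans (cong (suc k *_) (k>n⇒nCk≡0 (ℕ.n<1+n k))) (ℕ.*-zeroʳ (suc k))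
[1+k]*[j+k]C[1+k]≡j*[j+k]Ck (suc j) k = ℕ.+-cancelʳ-≡ (k * Y) _ _ (begin
  suc k * (suc n C suc k) + k * Y ≡⟨ cong (_+ k * Y) ([1+k]*[1+n]C[1+k]≡[1+n]*nCk n k) ⟩
  suc n * (n C k) + k * Y         ≡⟨ [1+n]*nCk+k*[1+n]Ck≡[1+n]*[1+n]Ck n k ⟩
  (suc j + k) * Y                 ≡⟨ ℕ.*-distribʳ-+ Y (suc j) k ⟩
  suc j * Y + k * Y               ∎)
  where
  n = j + k
  Y = suc n C k

-- ballot h r counts the paths that start h steps to the right of the diagonal and stay weakly
-- below it while making r right steps and h + r up steps, so that they end on the diagonal.
ballot : ℕ → ℕ → ℕ
ballot h       zero    = 1
ballot zero    (suc r) = ballot 1 r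
ballot (suc h) (suc r) = ballot (suc (suc h)) r + ballot h (suc r)

ballot-reflection : ∀ h i {M} → M ≡ i + (h + i) → ballot h i + M C suc (h + i) ≡ M C i
ballot-reflection h zero {M} refl = cong (λ x → 1 + x) (k>n⇒nCk≡0 (ℕ.n<1+n (h + 0)))
ballot-reflection zero (suc j) refl = begin
  ballot 1 j + suc M C suc (suc j)            ≡⟨ cong (λ x → ballot 1 j + x) (sym (nCk+nC[k+1]≡[n+1]C[k+1] M (suc j))) ⟩
  ballot 1 j + (M C suc j + M C suc (suc j))  ≡⟨ swap-+ (ballot 1 j) (M C suc j) _ ⟩
  M C suc j + (ballot 1 j + M C suc (suc j))  ≡⟨ cong (λ x → M C suc j + x) (ballot-reflection 1 j refl) ⟩
  M C suc j + M C j                           ≡⟨ ℕ.+-comm (M C suc j) (M C j) ⟩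
  M C j + M C suc j                           ≡⟨ nCk+nC[k+1]≡[n+1]C[k+1] M j ⟩
  suc M C suc j                               ∎
  where
  M = j + suc j
  swap-+ : ∀ a b c → a + (b + c) ≡ b + (a + c)
  swap-+ = solve-∀
ballot-reflection (suc g) (suc j) refl = begin
  (ballot (suc (suc g)) j + ballot g (suc j)) + suc K C suc k
    ≡⟨ cong (λ x → (ballot (suc (suc g)) j + ballot g (suc j)) + x) (sym (nCk+nC[k+1]≡[n+1]C[k+1] K k)) ⟩
  (ballot (suc (suc g)) j + ballot g (suc j)) + (K C k + K C suc k)
    ≡⟨ interchange (ballot (suc (suc g)) j) (ballot g (suc j)) (K C k) (K C suc k) ⟩
  (ballot (suc (suc g)) j + K C suc k) + (ballot g (suc j) + K C k)
    ≡⟨ cong₂ _+_ (trans (cong (λ x → ballot (suc (suc g)) j + K C suc (suc x)) (ℕ.+-suc g j))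
                        (ballot-reflection (suc (suc g)) j (heightˡ j g)))
                 (ballot-reflection g (suc j) (heightʳ j g)) ⟩
  K C j + K C suc j ≡⟨ nCk+nC[k+1]≡[n+1]C[k+1] K j ⟩
  suc K C suc j ∎
  where
  K = j + suc (g + suc j)
  k = suc (g + suc j)
  interchange : ∀ a b c d → (a + b) + (c + d) ≡ (a + d) + (b + c)
  interchange = solve-∀
  heightˡ : ∀ j g → j + suc (g + suc j) ≡ j + (suc (suc g) + j)
  heightˡ = solve-∀
  heightʳ : ∀ j g → j + suc (g + suc j) ≡ suc j + (g + suc j)
  heightʳ = solve-∀

ballot-closed-form : ∀ h i → ballot h i * suc (h + i) ≡ suc h * ((i + (h + i)) C (h + i))
ballot-closed-form h i = ℕ.+-cancelʳ-≡ (i * X) _ _ (begin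
  ballot h i * suc k + i * X               ≡⟨ cong (λ x → ballot h i * suc k + x) (sym ([1+k]*[j+k]C[1+k]≡j*[j+k]Ck i k)) ⟩
  ballot h i * suc k + suc k * (M C suc k) ≡⟨ factor-suc-k (ballot h i) (M C suc k) k ⟩
  (ballot h i + M C suc k) * suc k         ≡⟨ cong (_* suc k) (trans (ballot-reflection h i refl) ([m+n]Cm≡[m+n]Cn i k)) ⟩
  X * suc k                                ≡⟨ spread X h i ⟩
  suc h * X + i * X                        ∎)
  where
  k = h + i
  M = i + k
  X = M C k
  factor-suc-k : ∀ b c k → b * suc k + suc k * c ≡ (b + c) * suc k
  factor-suc-k = solve-∀
  spread : ∀ x h i → x * suc (h + i) ≡ suc h * x + i * x
  spread = solve-∀

ballot-ratio : ∀ g i → ballot (suc g) i * suc (suc g + i) * suc g ≡ suc (suc g) * suc (i + (g + i)) * ballot g i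
ballot-ratio g i = ℕ.*-cancelʳ-≡ _ _ (suc k) (begin
  ballot (suc g) i * suc (suc k) * suc g * suc k       ≡⟨ regroup (ballot (suc g) i) (suc (suc k)) (suc g) (suc k) ⟩
  ballot (suc g) i * suc (suc k) * (suc g * suc k)     ≡⟨ cong (_* (suc g * suc k)) (ballot-closed-form (suc g) i) ⟩
  suc (suc g) * ((i + suc k) C suc k) * (suc g * suc k) ≡⟨ cong (λ x → suc (suc g) * (x C suc k) * (suc g * suc k)) (ℕ.+-suc i k) ⟩
  suc (suc g) * (suc n C suc k) * (suc g * suc k)      ≡⟨ shuffle (suc (suc g)) (suc g) (suc k) (suc n C suc k) ⟩
  suc (suc g) * suc g * (suc k * (suc n C suc k))      ≡⟨ cong (suc (suc g) * suc g *_) ([1+k]*[1+n]C[1+k]≡[1+n]*nCk n k) ⟩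
  suc (suc g) * suc g * (suc n * (n C k))              ≡⟨ shuffle′ (suc (suc g)) (suc g) (suc n) (n C k) ⟩
  suc (suc g) * suc n * (suc g * (n C k))              ≡⟨ cong (suc (suc g) * suc n *_) (sym (ballot-closed-form g i)) ⟩
  suc (suc g) * suc n * (ballot g i * suc k)           ≡⟨ sym (ℕ.*-assoc (suc (suc g) * suc n) (ballot g i) (suc k)) ⟩
  suc (suc g) * suc n * ballot g i * suc k             ∎)
  where
  k = g + i
  n = i + k
  regroup : ∀ a b c d → a * b * c * d ≡ a * b * (c * d)
  regroup = solve-∀
  shuffle : ∀ a c d y → a * y * (c * d) ≡ a * c * (d * y)
  shuffle = solve-∀
  shuffle′ : ∀ a c e z → a * c * (e * z) ≡ a * e * (c * z)
  shuffle′ = solve-∀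

ballot-convolution : ∀ h N → ∑[ i < suc N ] (ballot h i * ballot 0 (N ∸ i)) ≡ ballot (suc h) N
ballot-convolution h       zero    = refl
ballot-convolution zero    (suc N) = begin
  1 * ballot 0 (suc N) + ∑[ i < suc N ] (ballot 1 i * ballot 0 (N ∸ i)) ≡⟨ cong (λ x → 1 * ballot 0 (suc N) + x) (ballot-convolution 1 N) ⟩
  1 * ballot 0 (suc N) + ballot 2 N                                     ≡⟨ ℕ.+-comm (1 * ballot 0 (suc N)) _ ⟩
  ballot 2 N + 1 * ballot 0 (suc N)                                     ≡⟨ cong (λ x → ballot 2 N + x) (ℕ.*-identityˡ _) ⟩
  ballot 2 N + ballot 0 (suc N)                                         ∎
ballot-convolution (suc g) (suc N) = begin
  1 * B (suc N) + ∑[ i < suc N ] ((ballot (suc (suc g)) i + ballot g (suc i)) * B (N ∸ i))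
    ≡⟨ cong (λ x → 1 * B (suc N) + x) (trans (∑-cong (suc N) λ i → ℕ.*-distribʳ-+ (B (N ∸ i)) (ballot (suc (suc g)) i) (ballot g (suc i)))
                                      (∑-distrib-+ (suc N) (λ i → ballot (suc (suc g)) i * B (N ∸ i)) (λ i → ballot g (suc i) * B (N ∸ i)))) ⟩
  1 * B (suc N) + (∑[ i < suc N ] (ballot (suc (suc g)) i * B (N ∸ i)) + ∑[ i < suc N ] (ballot g (suc i) * B (N ∸ i)))
    -- 1 * B (suc N) is the i = 0 term of the convolution for (g , suc N), as ballot g 0 = 1.
    ≡⟨ swap-+ (1 * B (suc N)) (∑[ i < suc N ] (ballot (suc (suc g)) i * B (N ∸ i))) (∑[ i < suc N ] (ballot g (suc i) * B (N ∸ i))) ⟩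
  ∑[ i < suc N ] (ballot (suc (suc g)) i * B (N ∸ i)) + ∑[ i < suc (suc N) ] (ballot g i * B (suc N ∸ i))
    ≡⟨ cong₂ _+_ (ballot-convolution (suc (suc g)) N) (ballot-convolution g (suc N)) ⟩
  ballot (suc (suc (suc g))) N + ballot (suc g) (suc N) ∎
  where
  B = ballot 0
  swap-+ : ∀ a b c → a + (b + c) ≡ b + (a + c)
  swap-+ = solve-∀

ballot-weighted : ∀ m i → (suc m + i + suc m + 1) * ballot (2 * suc m) i * suc m ≡ (2 * suc m + 1) * (suc m + i) * ballot (2 * suc m ∸ 1) i
ballot-weighted m i = ℕ.*-cancelˡ-≡ _ _ 2 (begin
  2 * ((suc m + i + suc m + 1) * B′ * suc m)                      ≡⟨ lhs m i B′ ⟩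
  B′ * suc (suc g + i) * suc g                                    ≡⟨ ballot-ratio g i ⟩
  suc (suc g) * suc (i + (g + i)) * B                             ≡⟨ rhs m i B ⟩
  2 * ((2 * suc m + 1) * (suc m + i) * B)                         ∎)
  where
  g = 2 * suc m ∸ 1
  B′ = ballot (suc g) i
  B = ballot g i
  lhs : ∀ m i b → 2 * ((suc m + i + suc m + 1) * b * suc m) ≡ b * suc (suc (m + suc (m + 0)) + i) * suc (m + suc (m + 0))
  lhs = solve-∀
  rhs : ∀ m i b → suc (suc (m + suc (m + 0))) * suc (i + ((m + suc (m + 0)) + i)) * b ≡ 2 * ((2 * suc m + 1) * (suc m + i) * b)
  rhs = solve-∀

length-filter-map : ∀ {a b p q} {A : Set a} {B : Set b} {P : Pred B p} {Q : Pred A q} (P? : Decidable P) (Q? : Decidable Q)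
                    (f : A → B) → (∀ x → P (f x) → Q x) → (∀ x → Q x → P (f x)) →
                    ∀ xs → length (filter P? (map f xs)) ≡ length (filter Q? xs)
length-filter-map P? Q? f to from [] = refl
length-filter-map P? Q? f to from (x ∷ xs) with P? (f x) | Q? x
... | yes p | yes _ = cong suc (length-filter-map P? Q? f to from xs)
... | yes p | no ¬q = contradiction (to x p) ¬q
... | no ¬p | yes q = contradiction (from x q) ¬p
... | no _  | no _  = length-filter-map P? Q? f to from xs

countPaths-step : ∀ {s} t l → Below s →
  countPaths s t (suc l) ≡ countPaths (move s right) t l + countPaths (move s up) t l
countPaths-step {s} t l below = begin
  length (filter (goodPath? s t) (map (right ∷_) paths ++ map (up ∷_) paths))
    ≡⟨ cong length (filter-++ (goodPath? s t) (map (right ∷_) paths) (map (up ∷_) paths)) ⟩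
  length (kept right ++ kept up)       ≡⟨ length-++ (kept right) ⟩
  length (kept right) + length (kept up) ≡⟨ cong₂ _+_ (first-step right) (first-step up) ⟩
  countPaths (move s right) t l + countPaths (move s up) t l ∎
  where
  paths = allSteps l
  kept : Step → List (List Step)
  kept x = filter (goodPath? s t) (map (x ∷_) paths)
  first-step : ∀ x → length (kept x) ≡ countPaths (move s x) t l
  first-step x = length-filter-map (goodPath? s t) (goodPath? (move s x) t) (x ∷_)
    (λ { _ (_ ∷ below-all , ends) → below-all , ends }) (λ _ (below-all , ends) → (below ∷ below-all) , ends) paths

countPaths-none : ∀ {s t} l → (∀ xs → ¬ GoodPath s t xs) → countPaths s t l ≡ 0
countPaths-none {s} {t} l bad = cong length (filter-none (goodPath? s t) (All.universal bad (allSteps l)))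

countPaths-nil : ∀ {s t} → Below s → s ≡ t → countPaths s t 0 ≡ 1
countPaths-nil {s} below refl = cong length (filter-accept (goodPath? s s) {x = []} {xs = []} ((below ∷ []) , refl))

countPaths-notBelow : ∀ {s} t l → ¬ Below s → countPaths s t l ≡ 0
countPaths-notBelow t l ¬below = countPaths-none l λ { [] (below ∷ _ , _) → ¬below below
                                                      ; (_ ∷ _) (below ∷ _ , _) → ¬below below }

endpoint-monoˣ : ∀ s xs → proj₁ s ℤ.≤ proj₁ (endpoint s xs)
endpoint-monoˣ s             []           = ℤ.≤-refl
endpoint-monoˣ s@(p , q)     (right ∷ xs) = ℤ.≤-trans (ℤ.i≤i+j p (+ 1)) (endpoint-monoˣ (move s right) xs)
endpoint-monoˣ s             (up ∷ xs)    = endpoint-monoˣ (move s up) xs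

countPaths-overshoot : ∀ {s t} l → ¬ proj₁ s ℤ.≤ proj₁ t → countPaths s t l ≡ 0
countPaths-overshoot {s} l s≰t = countPaths-none l λ { xs (_ , refl) → s≰t (endpoint-monoˣ s xs) }

i+1≰i+0 : ∀ i → ¬ i ℤ.+ + 1 ℤ.≤ i ℤ.+ + 0
i+1≰i+0 i i+1≤i = ℤ.<-irrefl refl (ℤ.suc[i]≤j⇒i<j (subst₂ ℤ._≤_ (ℤ.+-comm i (+ 1)) (ℤ.+-identityʳ i) i+1≤i))

i+[1+n]≡[i+1]+n : ∀ i n → i ℤ.+ + suc n ≡ (i ℤ.+ + 1) ℤ.+ + n
i+[1+n]≡[i+1]+n i n = sym (ℤ.+-assoc i (+ 1) (+ n))

countPaths-ballot : ∀ h r {p q d : ℤ} → p ≡ q ℤ.+ + h → d ≡ p ℤ.+ + r →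
                    countPaths (p , q) (d , d) (r + (h + r)) ≡ ballot h r
countPaths-ballot zero zero {p} {q} refl refl =
  countPaths-nil (ℤ.i≤i+j q (+ 0)) (cong₂ _,_ (sym (ℤ.+-identityʳ p)) (sym (trans (ℤ.+-identityʳ p) (ℤ.+-identityʳ q))))
countPaths-ballot (suc h) zero {p} {q} {d} refl refl = begin
  countPaths (p , q) (d , d) (suc (h + 0))
    ≡⟨ countPaths-step (d , d) (h + 0) (ℤ.i≤i+j q (+ suc h)) ⟩
  countPaths (p ℤ.+ + 1 , q) (d , d) (h + 0) + countPaths (p , q ℤ.+ + 1) (d , d) (h + 0)
    ≡⟨ cong₂ _+_ (countPaths-overshoot (h + 0) (i+1≰i+0 p))
                 (countPaths-ballot h zero (i+[1+n]≡[i+1]+n q h) refl) ⟩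
  0 + ballot h 0 ∎
countPaths-ballot zero (suc r) {p} {q} {d} refl refl = begin
  countPaths (p , q) (d , d) (suc (r + suc r))
    ≡⟨ countPaths-step (d , d) (r + suc r) (ℤ.i≤i+j q (+ 0)) ⟩
  countPaths (p ℤ.+ + 1 , q) (d , d) (r + suc r) + countPaths (p , q ℤ.+ + 1) (d , d) (r + suc r)
    ≡⟨ cong₂ _+_ (countPaths-ballot 1 r (cong (ℤ._+ + 1) (ℤ.+-identityʳ q)) (i+[1+n]≡[i+1]+n p r))
                 (countPaths-notBelow (d , d) (r + suc r) (i+1≰i+0 q)) ⟩
  ballot 1 r + 0 ≡⟨ ℕ.+-identityʳ _ ⟩
  ballot 1 r ∎
countPaths-ballot (suc h) (suc r) {p} {q} {d} refl refl = begin
  countPaths (p , q) (d , d) (suc (r + (suc h + suc r)))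
    ≡⟨ countPaths-step (d , d) (r + (suc h + suc r)) (ℤ.i≤i+j q (+ suc h)) ⟩
  countPaths (p ℤ.+ + 1 , q) (d , d) (r + (suc h + suc r)) + countPaths (p , q ℤ.+ + 1) (d , d) (r + (suc h + suc r))
    ≡⟨ cong₂ _+_ (cong (countPaths _ _) (cong (λ k → r + suc k) (ℕ.+-suc h r)))
                 (cong (countPaths _ _) (ℕ.+-suc r (h + suc r))) ⟩
  countPaths (p ℤ.+ + 1 , q) (d , d) (r + (suc (suc h) + r)) + countPaths (p , q ℤ.+ + 1) (d , d) (suc r + (h + suc r))
    ≡⟨ cong₂ _+_ (countPaths-ballot (suc (suc h)) r right-height (i+[1+n]≡[i+1]+n p r))
                 (countPaths-ballot h (suc r) (i+[1+n]≡[i+1]+n q h) refl) ⟩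
  ballot (suc (suc h)) r + ballot h (suc r) ∎
  where
  right-height : p ℤ.+ + 1 ≡ q ℤ.+ + suc (suc h)
  right-height = trans (ℤ.+-assoc q (+ suc h) (+ 1)) (cong (λ k → q ℤ.+ + k) (ℕ.+-comm (suc h) 1))

𝒞≡ballot : ∀ m i → 𝒞 (m + i) m ≡ ballot (2 * m) i
𝒞≡ballot m i = begin
  𝒞 (m + i) m ≡⟨ cong (countPaths _ _) (length-eq m i) ⟩
  countPaths (+ 0 , - + (2 * m)) (+ (m + i ∸ m) , + (m + i ∸ m)) (i + (2 * m + i))
    ≡⟨ countPaths-ballot (2 * m) i (sym (ℤ.+-inverseˡ (+ (2 * m)))) (cong +_ (ℕ.m+n∸m≡n m i)) ⟩
  ballot (2 * m) i ∎
  where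
  length-eq : ∀ m i → 2 * (m + i) ≡ i + (2 * m + i)
  length-eq = solve-∀

[2n]C[n+j]*[n∸j]≡[1+n+j]*[2n]C[1+n+j] : ∀ {n j} → j ≤ n → ((2 * n) C (n + j)) * (n ∸ j) ≡ suc (n + j) * ((2 * n) C suc (n + j))
[2n]C[n+j]*[n∸j]≡[1+n+j]*[2n]C[1+n+j] {n} {j} j≤n = begin
  ((2 * n) C k) * (n ∸ j)           ≡⟨ ℕ.*-comm ((2 * n) C k) (n ∸ j) ⟩
  (n ∸ j) * ((2 * n) C k)           ≡⟨ cong (λ M → (n ∸ j) * (M C k)) (sym split) ⟩
  (n ∸ j) * ((n ∸ j + k) C k)       ≡⟨ sym ([1+k]*[j+k]C[1+k]≡j*[j+k]Ck (n ∸ j) k) ⟩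
  suc k * ((n ∸ j + k) C suc k)     ≡⟨ cong (λ M → suc k * (M C suc k)) split ⟩
  suc k * ((2 * n) C suc k)         ∎
  where
  k = n + j
  split : n ∸ j + (n + j) ≡ 2 * n
  split = begin
    n ∸ j + (n + j) ≡⟨ cong (λ x → n ∸ j + x) (ℕ.+-comm n j) ⟩
    n ∸ j + (j + n) ≡⟨ sym (ℕ.+-assoc (n ∸ j) j n) ⟩
    n ∸ j + j + n   ≡⟨ cong (_+ n) (ℕ.m∸n+n≡m j≤n) ⟩
    n + n           ≡⟨ cong (λ x → n + x) (sym (ℕ.+-identityʳ n)) ⟩
    2 * n           ∎

[2n]Cn*∏[n∸j]≡∏[1+n+j]*[2n]C[n+m] : ∀ n m → m ≤ n →
  ((2 * n) C n) * ∏[ j < m ] (n ∸ j) ≡ ∏[ j < m ] (suc n + j) * ((2 * n) C (n + m))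
[2n]Cn*∏[n∸j]≡∏[1+n+j]*[2n]C[n+m] n m m≤n = begin
  ((2 * n) C n) * ∏[ j < m ] (n ∸ j)       ≡⟨ cong (λ k → ((2 * n) C k) * ∏[ j < m ] (n ∸ j)) (sym (ℕ.+-identityʳ n)) ⟩
  ((2 * n) C (n + 0)) * ∏[ j < m ] (n ∸ j) ≡⟨ ∏-telescope m (λ j → (2 * n) C (n + j)) (λ j → suc n + j) (λ j → n ∸ j) step ⟩
  ∏[ j < m ] (suc n + j) * ((2 * n) C (n + m)) ∎
  where
  step : ∀ j → j < m → ((2 * n) C (n + j)) * (n ∸ j) ≡ (suc n + j) * ((2 * n) C (n + suc j))
  step j j<m = trans ([2n]C[n+j]*[n∸j]≡[1+n+j]*[2n]C[1+n+j] (ℕ.≤-trans (ℕ.<⇒≤ j<m) m≤n))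
                     (cong (λ k → suc (n + j) * ((2 * n) C k)) (sym (ℕ.+-suc n j)))

sumQ-𝒞 : ∀ m n → suc m ≤ n →
  sumQ (suc m) n (λ k → frac (k + suc m + 1) k ℚ.* frac (𝒞 k (suc m) * 𝒞 (n ∸ k) 0) 1)
    ≡ frac ((2 * suc m + 1) * ballot (2 * suc m) (n ∸ suc m)) (suc m)
sumQ-𝒞 m n 1+m≤n = begin
  sumQ (suc m) n summand                ≡⟨ sumQ-frac (suc m) n summand F (suc m) term ⟩
  frac (∑ (suc n ∸ suc m) F) (suc m)    ≡⟨ cong (λ L → frac (∑ L F) (suc m)) (ℕ.+-∸-assoc 1 1+m≤n) ⟩
  frac (∑ (suc N) F) (suc m)            ≡⟨ cong (λ x → frac x (suc m)) (trans (∑-distribˡ-* (suc N) t (λ i → ballot g i * ballot 0 (N ∸ i))) (cong (t *_) (ballot-convolution g N))) ⟩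
  frac (t * ballot (2 * suc m) N) (suc m) ∎
  where
  N = n ∸ suc m
  t = 2 * suc m + 1
  g = 2 * suc m ∸ 1
  summand : ℕ → ℚ
  summand k = frac (k + suc m + 1) k ℚ.* frac (𝒞 k (suc m) * 𝒞 (n ∸ k) 0) 1
  F : ℕ → ℕ
  F i = t * (ballot g i * ballot 0 (N ∸ i))
  term : ∀ i → summand (suc m + i) ≡ frac (F i) (suc m)
  term i = begin
    frac (k + suc m + 1) k ℚ.* frac (𝒞 k (suc m) * 𝒞 (n ∸ k) 0) 1
      ≡⟨ cong (λ x → frac (k + suc m + 1) k ℚ.* frac x 1)
              (cong₂ _*_ (𝒞≡ballot (suc m) i) (trans (cong (λ j → 𝒞 j 0) (sym (ℕ.∸-+-assoc n (suc m) i))) (𝒞≡ballot 0 (N ∸ i)))) ⟩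
    frac (k + suc m + 1) k ℚ.* frac (ballot (2 * suc m) i * ballot 0 (N ∸ i)) 1
      ≡⟨ frac-* (k + suc m + 1) k (ballot (2 * suc m) i * ballot 0 (N ∸ i)) 1 ⟩
    frac ((k + suc m + 1) * (ballot (2 * suc m) i * ballot 0 (N ∸ i))) (k * 1)
      ≡⟨ frac-cross ((k + suc m + 1) * (ballot (2 * suc m) i * ballot 0 (N ∸ i))) (F i) (s≤s z≤n) (s≤s z≤n) cross ⟩
    frac (F i) (suc m) ∎
    where
    k = suc m + i
    cross : (k + suc m + 1) * (ballot (2 * suc m) i * ballot 0 (N ∸ i)) * suc m ≡ F i * (k * 1)
    cross = trans (move-B₀ (k + suc m + 1) (ballot (2 * suc m) i) (ballot 0 (N ∸ i)) (suc m))
                  (trans (cong (_* ballot 0 (N ∸ i)) (ballot-weighted m i))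
                         (move-B₀′ t k (ballot g i) (ballot 0 (N ∸ i))))
      where
      move-B₀ : ∀ w b b₀ m → w * (b * b₀) * m ≡ w * b * m * b₀
      move-B₀ = solve-∀
      move-B₀′ : ∀ t k b b₀ → t * k * b * b₀ ≡ t * (b * b₀) * (k * 1)
      move-B₀′ = solve-∀

prodQ-ratio : ∀ m n → prodQ 1 (m + 1) (λ k → frac (n + k) (n + 1 ∸ k)) ≡ frac (∏[ j < suc m ] (suc n + j)) (∏[ j < suc m ] (n ∸ j))
prodQ-ratio m n = trans (prodQ-frac 1 (m + 1) (λ k → frac (n + k) (n + 1 ∸ k)) (λ j → suc n + j) (λ j → n ∸ j) shift)
                        (cong (λ L → frac (∏[ j < L ] (suc n + j)) (∏[ j < L ] (n ∸ j))) (ℕ.+-comm m 1))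
  where
  shift : ∀ i → frac (n + suc i) (n + 1 ∸ suc i) ≡ frac (suc n + i) (n ∸ i)
  shift i = cong₂ frac (ℕ.+-suc n i) (cong (_∸ suc i) (ℕ.+-comm n 1))

corollary5p5-cross-multiplied : ∀ m n → m ≤ n →
  ((2 * n) C n) * ((2 * m + 1) ^ 2 * ∏[ j < suc m ] (n ∸ j) * m)
    ≡ m * (n ∸ m) * ∏[ j < suc m ] (suc n + j) * ((2 * m + 1) * ballot (2 * m) (n ∸ m))
corollary5p5-cross-multiplied m n m≤n = begin
  Cn * (t ^ 2 * ∏ (suc m) F * m)          ≡⟨ cong (λ x → Cn * (t ^ 2 * x * m)) (∏-snoc m F) ⟩
  Cn * (t ^ 2 * (P * N) * m)              ≡⟨ regroup₁ Cn t P N m ⟩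
  Cn * P * (t ^ 2 * N * m)                ≡⟨ cong (_* (t ^ 2 * N * m)) ([2n]Cn*∏[n∸j]≡∏[1+n+j]*[2n]C[n+m] n m m≤n) ⟩
  Q * K * (t ^ 2 * N * m)                 ≡⟨ regroup₂ Q K t N m ⟩
  m * N * Q * t * (t * K)                 ≡⟨ cong (m * N * Q * t *_) (sym closed-form) ⟩
  m * N * Q * t * (B * suc (2 * m + N))   ≡⟨ regroup₃ m N Q t B (suc (2 * m + N)) ⟩
  m * N * (Q * suc (2 * m + N)) * (t * B) ≡⟨ cong (λ x → m * N * x * (t * B)) (sym (trans (∏-snoc m G) (cong (Q *_) last-factor))) ⟩
  m * N * ∏ (suc m) G * (t * B)           ∎
  where
  N = n ∸ m
  t = 2 * m + 1
  F G : ℕ → ℕ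
  F j = n ∸ j
  G j = suc n + j
  Cn = (2 * n) C n
  P = ∏ m F
  Q = ∏ m G
  K = (2 * n) C (n + m)
  B = ballot (2 * m) N
  n≡m+N : m + N ≡ n
  n≡m+N = ℕ.m+[n∸m]≡n m≤n
  top : ∀ m N → N + (2 * m + N) ≡ 2 * (m + N)
  top = solve-∀
  index : ∀ m N → 2 * m + N ≡ m + N + m
  index = solve-∀
  after : ∀ m N → suc (m + N) + m ≡ suc (2 * m + N)
  after = solve-∀
  closed-form : B * suc (2 * m + N) ≡ t * K
  closed-form = trans (ballot-closed-form (2 * m) N)
                     (cong₂ _*_ (ℕ.+-comm 1 (2 * m)) (cong₂ _C_ (trans (top m N) (cong (2 *_) n≡m+N))
                                                                (trans (index m N) (cong (_+ m) n≡m+N))))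
  last-factor : suc n + m ≡ suc (2 * m + N)
  last-factor = trans (cong (λ x → suc x + m) (sym n≡m+N)) (after m N)
  regroup₁ : ∀ c u p x y → c * (u * (u * 1) * (p * x) * y) ≡ c * p * (u * (u * 1) * x * y)
  regroup₁ = solve-∀
  regroup₂ : ∀ q k u x y → q * k * (u * (u * 1) * x * y) ≡ y * x * q * u * (u * k)
  regroup₂ = solve-∀
  regroup₃ : ∀ y x q u b s → y * x * q * u * (b * s) ≡ y * x * (q * s) * (u * b)
  regroup₃ = solve-∀

corollary5p5 : (m n : ℕ) → 1 ≤ m → m < n →
    frac ((2 * n) C n) 1
      ≡ frac (m * (n ∸ m)) ((2 * m + 1) ^ 2)
        ℚ.* prodQ 1 (m + 1) (λ k → frac (n + k) (n + 1 ∸ k))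
        ℚ.* sumQ m n (λ k → frac (k + m + 1) k ℚ.* frac (𝒞 k m * 𝒞 (n ∸ k) 0) 1)
corollary5p5 m@(suc m₀) n (s≤s z≤n) m<n = sym (begin
  frac (m * (n ∸ m)) ((2 * m + 1) ^ 2) ℚ.* prodQ 1 (m + 1) (λ k → frac (n + k) (n + 1 ∸ k))
    ℚ.* sumQ m n (λ k → frac (k + m + 1) k ℚ.* frac (𝒞 k m * 𝒞 (n ∸ k) 0) 1)
    ≡⟨ cong₂ (λ p s → frac (m * (n ∸ m)) ((2 * m + 1) ^ 2) ℚ.* p ℚ.* s) (prodQ-ratio m n) (sumQ-𝒞 m₀ n (ℕ.<⇒≤ m<n)) ⟩
  frac (m * (n ∸ m)) ((2 * m + 1) ^ 2) ℚ.* frac (∏[ j < suc m ] (suc n + j)) (∏[ j < suc m ] (n ∸ j))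
    ℚ.* frac ((2 * m + 1) * ballot (2 * m) (n ∸ m)) m
    ≡⟨ frac-*₃ (m * (n ∸ m)) ((2 * m + 1) ^ 2) (∏[ j < suc m ] (suc n + j)) (∏[ j < suc m ] (n ∸ j)) ((2 * m + 1) * ballot (2 * m) (n ∸ m)) m ⟩
  frac (m * (n ∸ m) * ∏[ j < suc m ] (suc n + j) * ((2 * m + 1) * ballot (2 * m) (n ∸ m))) ((2 * m + 1) ^ 2 * ∏[ j < suc m ] (n ∸ j) * m)
    ≡⟨ frac-cross _ ((2 * n) C n) denominator-pos (s≤s z≤n) (trans (ℕ.*-identityʳ _) (sym (corollary5p5-cross-multiplied m n (ℕ.<⇒≤ m<n)))) ⟩
  frac ((2 * n) C n) 1 ∎)
  where
  denominator-pos : 0 < (2 * m + 1) ^ 2 * ∏[ j < suc m ] (n ∸ j) * m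
  denominator-pos = ℕ.*-mono-< (ℕ.*-mono-< square-pos factors-pos) (s≤s z≤n)
    where
    square-pos : 0 < (2 * m + 1) ^ 2
    square-pos = s≤s z≤n
    factors-pos : 0 < ∏[ j < suc m ] (n ∸ j)
    factors-pos = ∏-pos (suc m) (λ j → n ∸ j) λ j j≤m → ℕ.m<n⇒0<n∸m (ℕ.≤-<-trans (ℕ.s≤s⁻¹ j≤m) m<n)
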